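{- Let $\phi=\frac{1+\sqrt5}2$, $a_1(n)=\lfloor n\phi\rfloor$, $a_2(n)=\lfloor n(\phi+1)\rfloor$, $b_1(n)=a_1(n)+g(n)-1$, $b_2(n)=a_2(n)+g(n)$, where $g$ is as in the context. Let $n,m\in\mathbb{N}$ satisfy $a_1(n)=a_2(m)+1=a_1(n-1)+2$. Then one of the following holds: (i) $\lfloor n\phi\rfloor=b_1(n)$, $\lfloor n\phi\rfloor-1=b_2(m)$, and $b_1(n-1)<b_2(m)<b_1(n)<b_2(m+1)$; (ii) $\lfloor n\phi\rfloor=b_2(m)$, $\lfloor n\phi\rfloor-1=b_1(n)$, $b_1(n-1)<b_1(n)<b_2(m)$, and $b_2(m-1)<b_1(n)<b_2(m)$.
   Context: $g:\mathbb{Z}_{\geq0}\to\{0,1\}$ is defined by $g(0)=1$, $g(1)=0$ and, for $n\ge2$, $g(n)=1-g(m)$ if there is $m\in\mathbb{Z}_{\geq0}$ with $\lfloor n\phi\rfloor=\lfloor m(\phi+1)\rfloor+1$, and $g(n)=1$ otherwise. $\mathbb{N}$ denotes the positive integers. -}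

module Defs where

open import Data.Nat using (ℕ; zero; suc; _+_; _*_; _∸_; _≤ᵇ_; _≡ᵇ_)
open import Data.Bool using (Bool; true; false; if_then_else_)
open import Data.Maybe using (Maybe; just; nothing)

-- Number of k ∈ {1,…,B} satisfying P.  For a downward-closed predicate
-- "k ≤ x" with 0 ≤ x < B+1 this is exactly ⌊x⌋.
countUpTo : (ℕ → Bool) → ℕ → ℕ
countUpTo P zero    = 0
countUpTo P (suc k) = (if P (suc k) then 1 else 0) + countUpTo P k

-- k ≤ n·φ  ⟺  2k − n ≤ n√5  ⟺  (2k ∸ n)² ≤ 5n²   (φ = (1+√5)/2)
leNPhi : ℕ → ℕ → Bool
leNPhi n k = ((2 * k ∸ n) * (2 * k ∸ n)) ≤ᵇ (5 * (n * n))

-- k ≤ n·(φ+1)  ⟺  2k − 3n ≤ n√5  ⟺  (2k ∸ 3n)² ≤ 5n²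
leNPhi1 : ℕ → ℕ → Bool
leNPhi1 n k = ((2 * k ∸ 3 * n) * (2 * k ∸ 3 * n)) ≤ᵇ (5 * (n * n))

-- a₁(n) = ⌊n φ⌋   (n φ ≤ 2n)
a₁ : ℕ → ℕ
a₁ n = countUpTo (leNPhi n) (2 * n)

-- a₂(n) = ⌊n (φ+1)⌋   (n (φ+1) ≤ 3n)
a₂ : ℕ → ℕ
a₂ n = countUpTo (leNPhi1 n) (3 * n)

findBelow : (ℕ → Bool) → ℕ → Maybe ℕ
findBelow P zero = nothing
findBelow P (suc B) with findBelow P B
... | just m  = just m
... | nothing = if P B then just B else nothing

-- g with fuel.  For n ≥ 2 any m with a₁(n) = a₂(m)+1 satisfies m < n,
-- and such m is unique (a₂ strictly increasing), so searching m < n is exact.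
gF : ℕ → ℕ → ℕ
gF zero    _ = 1
gF (suc f) zero = 1
gF (suc f) (suc zero) = 0
gF (suc f) (suc (suc k)) with findBelow (λ m → a₁ (suc (suc k)) ≡ᵇ (a₂ m + 1)) (suc (suc k))
... | just m  = 1 ∸ gF f m
... | nothing = 1

g : ℕ → ℕ
g n = gF (suc n) n

-- b₁(n) = a₁(n) + g(n) − 1  (never negative: a₁(n) ≥ 1 for n ≥ 1, g(0) = 1)
b₁ : ℕ → ℕ
b₁ n = a₁ n + g n ∸ 1

b₂ : ℕ → ℕ
b₂ n = a₂ n + g n

-- Whenever ⌊nφ⌋ = ⌊m(φ+1)⌋ + 1, the definition of g makes g(n) and g(m)
-- complementary bits, so b₁(n) and b₂(m) are ⌊nφ⌋ and ⌊nφ⌋ − 1 in one order or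
-- the other.  All inequalities then follow from b₁ ≤ a₁ and a₂ ≤ b₂ ≤ a₂ + 1
-- together with the fact that consecutive values of ⌊m(φ+1)⌋ differ by at
-- least 2, because φ + 1 > 2.
module Submission where

open import Defs
open import Data.Bool using (Bool; T; true; false)
open import Data.Empty using (⊥-elim)
open import Data.Maybe using (just; nothing)
open import Data.Nat
  using (ℕ; zero; suc; _+_; _*_; _∸_; _<_; _≥_; _≤_; _≤′_; ≤′-refl; ≤′-step; z≤n; s≤s; _≡ᵇ_)
open import Data.Nat.Properties
open import Data.Nat.Tactic.RingSolver using (solve-∀)
open import Data.Product using (_×_; _,_; ∃; proj₁; proj₂)
open import Data.Sum using (_⊎_; inj₁; inj₂)
open import Relation.Binary.PropositionalEquality

DownwardClosed : (ℕ → Bool) → Set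
DownwardClosed P = ∀ {j k} → j ≤ k → T (P k) → T (P j)

module _ (P : ℕ → Bool) where

  countUpTo-≤ : ∀ B → countUpTo P B ≤ B
  countUpTo-≤ zero = z≤n
  countUpTo-≤ (suc B) with P (suc B)
  ... | true  = s≤s (countUpTo-≤ B)
  ... | false = m≤n⇒m≤1+n (countUpTo-≤ B)

  countUpTo-≤-suc : ∀ B → countUpTo P B ≤ countUpTo P (suc B)
  countUpTo-≤-suc B with P (suc B)
  ... | true  = n≤1+n _
  ... | false = ≤-refl

  countUpTo-mono : ∀ {c B} → c ≤ B → countUpTo P c ≤ countUpTo P B
  countUpTo-mono c≤B = go (≤⇒≤′ c≤B)
    where
    go : ∀ {c B} → c ≤′ B → countUpTo P c ≤ countUpTo P B
    go ≤′-refl        = ≤-refl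
    go (≤′-step c≤′B) = ≤-trans (go c≤′B) (countUpTo-≤-suc _)

  module _ (closed : DownwardClosed P) where

    countUpTo-full : ∀ B → T (P B) → countUpTo P B ≡ B
    countUpTo-full zero    _   = refl
    countUpTo-full (suc B) PsB with P (suc B) in PsB≡
    ... | true = cong suc (countUpTo-full B (closed (n≤1+n B) (subst T (sym PsB≡) _)))

    countUpTo-≥ : ∀ {c B} → T (P c) → c ≤ B → c ≤ countUpTo P B
    countUpTo-≥ {c} {B} Pc c≤B = begin
      c               ≡⟨ countUpTo-full c Pc ⟨
      countUpTo P c   ≤⟨ countUpTo-mono c≤B ⟩
      countUpTo P B   ∎
      where open ≤-Reasoning

    countUpTo-satisfies : T (P 0) → ∀ B → T (P (countUpTo P B))
    countUpTo-satisfies P0 zero = P0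
    countUpTo-satisfies P0 (suc B) with P (suc B) in PsB≡
    ... | false = countUpTo-satisfies P0 B
    ... | true  = subst (λ c → T (P (suc c))) (sym (countUpTo-full B PB)) PsB
      where
      PsB : T (P (suc B))
      PsB = subst T (sym PsB≡) _
      PB : T (P B)
      PB = closed (n≤1+n B) PsB

suc[m]∸n≤suc[m∸n] : ∀ m n → suc m ∸ n ≤ suc (m ∸ n)
suc[m]∸n≤suc[m∸n] m       zero    = ≤-refl
suc[m]∸n≤suc[m∸n] zero    (suc n) = m∸n≤m 1 (suc n)
suc[m]∸n≤suc[m∸n] (suc m) (suc n) = suc[m]∸n≤suc[m∸n] m n

leNPhi1-zero : ∀ m → T (leNPhi1 m 0)
leNPhi1-zero m = ≤⇒≤ᵇ (subst (λ x → x * x ≤ 5 * (m * m)) (sym (0∸n≡0 (3 * m))) z≤n)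

leNPhi1-downwardClosed : ∀ m → DownwardClosed (leNPhi1 m)
leNPhi1-downwardClosed m {j} {k} j≤k Pk =
  ≤⇒≤ᵇ (≤-trans (*-mono-≤ x≤ x≤) (≤ᵇ⇒≤ _ _ Pk))
  where
  x≤ : 2 * j ∸ 3 * m ≤ 2 * k ∸ 3 * m
  x≤ = ∸-monoˡ-≤ (3 * m) (*-monoʳ-≤ 2 j≤k)

-- In real terms: c ≤ m(φ+1) implies c + 2 ≤ (m+1)(φ+1), because φ + 1 > 2.
leNPhi1-step : ∀ {m c} → c ≤ 3 * m → T (leNPhi1 m c) → T (leNPhi1 (suc m) (2 + c))
leNPhi1-step {m} {c} c≤3m Pc = ≤⇒≤ᵇ (begin
  y * y                                          ≤⟨ *-mono-≤ y≤1+x y≤1+x ⟩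
  suc x * suc x                                  ≡⟨ square-suc x ⟩
  x * x + (2 * x + 1)                            ≤⟨ +-mono-≤ x²≤5m² (+-monoˡ-≤ 1 (*-monoʳ-≤ 2 x≤3m)) ⟩
  5 * (m * m) + (2 * (3 * m) + 1)                ≤⟨ m≤m+n _ (4 * m + 4) ⟩
  5 * (m * m) + (2 * (3 * m) + 1) + (4 * m + 4)  ≡⟨ expand m ⟩
  5 * (suc m * suc m)                            ∎)
  where
  open ≤-Reasoning
  x = 2 * c ∸ 3 * m
  y = 2 * (2 + c) ∸ 3 * suc m
  y≤1+x : y ≤ suc x
  y≤1+x = ≤-trans (≤-reflexive (cong₂ _∸_ (*-distribˡ-+ 2 2 c) (*-suc 3 m)))
                  (suc[m]∸n≤suc[m∸n] (2 * c) (3 * m))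
  x²≤5m² : x * x ≤ 5 * (m * m)
  x²≤5m² = ≤ᵇ⇒≤ (x * x) (5 * (m * m)) Pc
  x≤3m : x ≤ 3 * m
  x≤3m = m≤n+o⇒m∸n≤o (2 * c) (3 * m)
           (≤-trans (*-monoʳ-≤ 2 c≤3m) (≤-reflexive (cong (3 * m +_) (+-identityʳ (3 * m)))))
  square-suc : ∀ x → suc x * suc x ≡ x * x + (2 * x + 1)
  square-suc = solve-∀
  expand : ∀ m → 5 * (m * m) + (2 * (3 * m) + 1) + (4 * m + 4) ≡ 5 * (suc m * suc m)
  expand = solve-∀

a₁-≤ : ∀ n → a₁ n ≤ 2 * n
a₁-≤ n = countUpTo-≤ (leNPhi n) (2 * n)

a₂-≤ : ∀ m → a₂ m ≤ 3 * m
a₂-≤ m = countUpTo-≤ (leNPhi1 m) (3 * m)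

a₂-gap : ∀ m → 2 + a₂ m ≤ a₂ (suc m)
a₂-gap m = countUpTo-≥ (leNPhi1 (suc m)) (leNPhi1-downwardClosed (suc m))
  (leNPhi1-step {m} (a₂-≤ m) a₂m-satisfies) 2+a₂m≤3[1+m]
  where
  a₂m-satisfies : T (leNPhi1 m (a₂ m))
  a₂m-satisfies = countUpTo-satisfies (leNPhi1 m) (leNPhi1-downwardClosed m) (leNPhi1-zero m) (3 * m)
  2+a₂m≤3[1+m] : 2 + a₂ m ≤ 3 * suc m
  2+a₂m≤3[1+m] = ≤-trans (s≤s (s≤s (m≤n⇒m≤1+n (a₂-≤ m)))) (≤-reflexive (sym (*-suc 3 m)))

2m≤a₂ : ∀ m → 2 * m ≤ a₂ m
2m≤a₂ zero    = z≤n
2m≤a₂ (suc m) = begin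
  2 * suc m   ≡⟨ *-suc 2 m ⟩
  2 + 2 * m   ≤⟨ +-monoʳ-≤ 2 (2m≤a₂ m) ⟩
  2 + a₂ m    ≤⟨ a₂-gap m ⟩
  a₂ (suc m)  ∎
  where open ≤-Reasoning

a₂-<-mono : ∀ {m k} → m < k → a₂ m < a₂ k
a₂-<-mono {m} m<k = go (≤⇒≤′ m<k)
  where
  go : ∀ {k} → suc m ≤′ k → a₂ m < a₂ k
  go ≤′-refl           = ≤-trans (n≤1+n _) (a₂-gap m)
  go (≤′-step {k} m<k) = ≤-trans (go m<k) (≤-trans (m≤n+m _ 2) (a₂-gap k))

a₂-cancel-≤ : ∀ {m k} → a₂ m ≤ a₂ k → m ≤ k
a₂-cancel-≤ a₂m≤a₂k = ≮⇒≥ (λ k<m → <⇒≱ (a₂-<-mono k<m) a₂m≤a₂k)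

a₂-injective : ∀ {m k} → a₂ m ≡ a₂ k → m ≡ k
a₂-injective e = ≤-antisym (a₂-cancel-≤ (≤-reflexive e)) (a₂-cancel-≤ (≤-reflexive (sym e)))

module _ (P : ℕ → Bool) where

  findBelow-sound : ∀ {B y} → findBelow P B ≡ just y → T (P y) × y < B
  findBelow-sound {suc B} found with findBelow P B in found′
  findBelow-sound {suc B} refl | just y with findBelow-sound found′
  ... | Py , y<B = Py , m≤n⇒m≤1+n y<B
  findBelow-sound {suc B} found | nothing with P B in PB≡
  findBelow-sound {suc B} refl | nothing | true = subst T (sym PB≡) _ , ≤-refl

  findBelow-complete : ∀ {B x} → T (P x) → x < B → ∃ λ y → findBelow P B ≡ just y
  findBelow-complete {suc B} {x} Px (s≤s x≤B) with findBelow P B in found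
  ... | just y  = y , refl
  ... | nothing with m≤n⇒m<n∨m≡n x≤B
  ...   | inj₁ x<B with () ← trans (sym found) (proj₂ (findBelow-complete Px x<B))
  ...   | inj₂ refl with P x | Px
  ...     | true | _ = x , refl

a₁≡ᵇa₂+1 : ℕ → ℕ → Bool
a₁≡ᵇa₂+1 n m = a₁ n ≡ᵇ (a₂ m + 1)

gF≤1 : ∀ f n → gF f n ≤ 1
gF≤1 zero          _             = ≤-refl
gF≤1 (suc f)       zero          = ≤-refl
gF≤1 (suc f)       (suc zero)    = z≤n
gF≤1 (suc f)       (suc (suc k)) with findBelow (a₁≡ᵇa₂+1 (2 + k)) (2 + k)
... | just m  = m∸n≤m 1 (gF f m)
... | nothing = ≤-refl

gF-fuel-irrelevant : ∀ {f f′} n → n < f → n < f′ → gF f n ≡ gF f′ n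
gF-fuel-irrelevant {suc f} {suc f′} zero          _ _ = refl
gF-fuel-irrelevant {suc f} {suc f′} (suc zero)    _ _ = refl
gF-fuel-irrelevant {suc f} {suc f′} (suc (suc k)) (s≤s n≤f) (s≤s n≤f′)
  with findBelow (a₁≡ᵇa₂+1 (2 + k)) (2 + k) in found
... | just m  = cong (1 ∸_) (gF-fuel-irrelevant m (<-≤-trans m<n n≤f) (<-≤-trans m<n n≤f′))
  where m<n = proj₂ (findBelow-sound _ found)
... | nothing = refl

g≤1 : ∀ n → g n ≤ 1
g≤1 n = gF≤1 (suc n) n

g-found : ∀ k {m} → findBelow (a₁≡ᵇa₂+1 (2 + k)) (2 + k) ≡ just m → g (2 + k) ≡ 1 ∸ g m
g-found k {m} found rewrite found =
  cong (1 ∸_) (gF-fuel-irrelevant m (proj₂ (findBelow-sound _ found)) ≤-refl)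

a₁≡a₂+1⇒m<n : ∀ {n m} → a₁ n ≡ a₂ m + 1 → m < n
a₁≡a₂+1⇒m<n {n} {m} a₁n≡ = *-cancelˡ-< 2 m n (begin
  suc (2 * m)   ≤⟨ s≤s (2m≤a₂ m) ⟩
  suc (a₂ m)    ≡⟨ +-comm 1 (a₂ m) ⟩
  a₂ m + 1      ≡⟨ a₁n≡ ⟨
  a₁ n          ≤⟨ a₁-≤ n ⟩
  2 * n         ∎)
  where open ≤-Reasoning

g-complement : ∀ {n m} → a₁ n ≡ a₂ m + 1 → g n ≡ 1 ∸ g m
g-complement {zero}        {m} a₁n≡ = ⊥-elim (m+1+n≢0 (a₂ m) (sym a₁n≡))
g-complement {suc zero}    {m} a₁n≡
  with refl ← a₂-injective {m} {0} (+-cancelʳ-≡ 1 (a₂ m) 0 (sym a₁n≡))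
  = refl
g-complement {n@(suc (suc k))} {m} a₁n≡
  with y , found ← findBelow-complete (a₁≡ᵇa₂+1 n) (≡⇒≡ᵇ (a₁ n) (a₂ m + 1) a₁n≡) (a₁≡a₂+1⇒m<n {n} {m} a₁n≡)
  with a₁n≡′ ← ≡ᵇ⇒≡ (a₁ n) (a₂ y + 1) (proj₁ (findBelow-sound (a₁≡ᵇa₂+1 n) {n} found))
  with refl ← a₂-injective {y} {m} (+-cancelʳ-≡ 1 (a₂ y) (a₂ m) (trans (sym a₁n≡′) a₁n≡))
  = g-found k found

b₁≤a₁ : ∀ n → b₁ n ≤ a₁ n
b₁≤a₁ n = m≤n+o⇒m∸n≤o (a₁ n + g n) 1
  (≤-trans (+-monoʳ-≤ (a₁ n) (g≤1 n)) (≤-reflexive (+-comm (a₁ n) 1)))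

b₂<a₂-suc : ∀ m → b₂ m < a₂ (suc m)
b₂<a₂-suc m = ≤-trans (s≤s (≤-trans (+-monoʳ-≤ (a₂ m) (g≤1 m)) (≤-reflexive (+-comm (a₂ m) 1))))
  (a₂-gap m)

b₁-b₂-values : ∀ {n m} → a₁ n ≡ suc (a₂ m) →
  (b₁ n ≡ a₁ n × b₂ m ≡ a₂ m) ⊎ (b₁ n ≡ a₂ m × b₂ m ≡ a₁ n)
b₁-b₂-values {n} {m} a₁n≡
  with gn≡ ← g-complement {n} {m} (trans a₁n≡ (+-comm 1 (a₂ m)))
  with n≤1⇒n≡0∨n≡1 (g≤1 m)
... | inj₁ gm≡0 = inj₁ (b₁n≡ , trans (cong (a₂ m +_) gm≡0) (+-identityʳ (a₂ m)))
  where
  b₁n≡ : b₁ n ≡ a₁ n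
  b₁n≡ = begin
    a₁ n + g n ∸ 1  ≡⟨ cong (λ t → a₁ n + t ∸ 1) (trans gn≡ (cong (1 ∸_) gm≡0)) ⟩
    a₁ n + 1 ∸ 1    ≡⟨ m+n∸n≡m (a₁ n) 1 ⟩
    a₁ n            ∎
    where open ≡-Reasoning
... | inj₂ gm≡1 = inj₂ (b₁n≡ , trans (cong (a₂ m +_) gm≡1) (trans (+-comm (a₂ m) 1) (sym a₁n≡)))
  where
  b₁n≡ : b₁ n ≡ a₂ m
  b₁n≡ = begin
    a₁ n + g n ∸ 1  ≡⟨ cong (λ t → a₁ n + t ∸ 1) (trans gn≡ (cong (1 ∸_) gm≡1)) ⟩
    a₁ n + 0 ∸ 1    ≡⟨ cong (_∸ 1) (trans (+-identityʳ (a₁ n)) a₁n≡) ⟩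
    a₂ m            ∎
    where open ≡-Reasoning

interleave : ∀ {A x u v l l′ r} → A ≡ suc x → (u ≡ A × v ≡ x) ⊎ (u ≡ x × v ≡ A) →
  l < x → l′ < x → A < r →
  (A ≡ u × A ∸ 1 ≡ v × l < v × v < u × u < r)
  ⊎ (A ≡ v × A ∸ 1 ≡ u × l < u × u < v × l′ < u × u < v)
interleave refl (inj₁ (refl , refl)) l<x _    A<r = inj₁ (refl , refl , l<x , ≤-refl , A<r)
interleave refl (inj₂ (refl , refl)) l<x l′<x _   = inj₂ (refl , refl , l<x , ≤-refl , l′<x , ≤-refl)

lemma3p3 : (n m : ℕ) → n ≥ 1 → m ≥ 1 →
    a₁ n ≡ a₂ m + 1 → a₂ m + 1 ≡ a₁ (n ∸ 1) + 2 →
    (a₁ n ≡ b₁ n × a₁ n ∸ 1 ≡ b₂ m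
      × b₁ (n ∸ 1) < b₂ m × b₂ m < b₁ n × b₁ n < b₂ (suc m))
    ⊎ (a₁ n ≡ b₂ m × a₁ n ∸ 1 ≡ b₁ n
      × b₁ (n ∸ 1) < b₁ n × b₁ n < b₂ m
      × b₂ (m ∸ 1) < b₁ n × b₁ n < b₂ m)
lemma3p3 n (suc m) _ _ a₁n≡ a₁[n-1]≡ =
  interleave a₁n≡1+x (b₁-b₂-values {n} {suc m} a₁n≡1+x) b₁[n-1]<x (b₂<a₂-suc m) a₁n<b₂[m+2]
  where
  x = a₂ (suc m)
  a₁n≡1+x : a₁ n ≡ suc x
  a₁n≡1+x = trans a₁n≡ (+-comm x 1)
  1+a₁[n-1]≡x : suc (a₁ (n ∸ 1)) ≡ x
  1+a₁[n-1]≡x = +-cancelʳ-≡ 1 _ x (trans (sym (+-suc (a₁ (n ∸ 1)) 1)) (sym a₁[n-1]≡))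
  b₁[n-1]<x : b₁ (n ∸ 1) < x
  b₁[n-1]<x = ≤-<-trans (b₁≤a₁ (n ∸ 1)) (≤-reflexive 1+a₁[n-1]≡x)
  a₁n<b₂[m+2] : a₁ n < b₂ (suc (suc m))
  a₁n<b₂[m+2] = subst (_< b₂ (suc (suc m))) (sym a₁n≡1+x) (≤-trans (a₂-gap (suc m)) (m≤m+n _ _))
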